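{- Let $G=(V,E)$ be a connected graph on $n$ vertices with positive integer edge weights $w$, let $k\ge 2$ be an integer, $\varepsilon>0$, $t=(2k-1)(1+\varepsilon)$, and fix $i\in\{1,\dots,\lceil\log_k n\rceil\}$. Let $H$, $Z$, $v_1,\dots,v_n$, $L$, $E_i$, $a$, $s$, the intervals $I_1,\dots,I_s$, the indices $h(u)$, the representatives $r_1,\dots,r_s$, the neighborhoods $N_b(j)$, and the multigraph $K=(R,F)$ be as defined in the context (with $s$ and $L/s$ integers). Then $K$ has no parallel edges: no unordered pair $\{q,q'\}$ of representatives belongs to the matchings $M_e$ and $M_{e'}$ of two distinct edges $e\neq e'$ of $E_i$.
   Context: Greedy spanner: fix a total order on $E$ non-decreasing in weight (ties broken lexicographically); $Z$ is the (unique) minimum spanning tree w.r.t. this order; $H$ is obtained by starting from $(V,\emptyset)$ and scanning edges in this order, adding $\{u,v\}$ iff currently $d_H(u,v)>t\cdot w(u,v)$. Let $v_1,\dots,v_n$ be a preorder traversal of $Z$ from some root, $L=\sum_{j=2}^n d_Z(v_{j-1},v_j)$, and $E_i=\{e\in E(H)\setminus E(Z): w(e)\in(k^{i-1},k^i]\cdot L/n\}$. Let $a=k^{i-1}L/n$ and $s=8L/(\varepsilon a)$; assume $s$ and $L/s=\varepsilon a/8$ are integers. Let $P=(p_0,\dots,p_L)$ be a path of unit-length edges, where each vertex $v_j$ is identified with the point $p_{\pi(j)}$, $\pi(j)=\sum_{h=2}^{j}d_Z(v_{h-1},v_h)$ (so $p_0=v_1$, $p_L=v_n$; other points are Steiner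 points). For $j\in\{1,\dots,s\}$ let the interval $I_j=\{p_{(j-1)L/s},\dots,p_{jL/s}\}$; for each $u\in V$ fix an index $h(u)$ with $u\in I_{h(u)}$. In each $I_j$ choose an arbitrary interior point $r_j$ as representative, $R=\{r_1,\dots,r_s\}$, and for integer $b\ge 0$ let $N_b(j)=\{r_h: 1\le h\le s,\ |j-h|\le b\}$. The multigraph $K=(R,F)$: for each $e=\{u,v\}\in E_i$ with $h=h(u)$, $j=h(v)$, $b=\lfloor w(e)/a\rfloor$, choose an arbitrary maximal matching $M_e$ between $N_b(h)$ and $N_b(j)$ (a maximal set of pairs $\{q,q'\}$ with $q\in N_b(h)$, $q'\in N_b(j)$, each representative in at most one pair) and add all its pairs as edges to $F$. -}

module Defs where

open import Data.Nat using (ℕ; zero; suc; _+_; _*_; _∸_; _^_; _<_; _≤_; ∣_-_∣)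
open import Data.Fin using (Fin; toℕ)
open import Data.List using (List; []; _∷_; _++_; [_]; concatMap)
open import Data.List.Membership.Propositional using (_∈_; _∉_)
open import Data.List.Relation.Unary.All using (All)
open import Data.List.Relation.Unary.Unique.Propositional using (Unique)
open import Data.Product using (Σ; ∃; ∃-syntax; _×_; _,_; proj₁; proj₂)
open import Data.Sum using (_⊎_)
open import Data.Integer using (+_)
open import Data.Rational as ℚ using (ℚ)
open import Relation.Binary.PropositionalEquality using (_≡_; _≢_)
open import Relation.Nullary using (¬_)
open import Data.Empty using (⊥)

-- Conventions
--  * vertices are Fin n;
--  * an (undirected) edge {x,y} is stored as the pair (x , y) with
--    toℕ x < toℕ y;  the weight function is w : Fin n → Fin n → ℕ and
--    the weight of the stored edge (x , y) is w x y;
--  * a (sub)graph on Fin n is given by a list of its edges.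

Edge : ℕ → Set
Edge n = Fin n × Fin n

ℕ→ℚ : ℕ → ℚ
ℕ→ℚ d = (+ d) ℚ./ 1

module _ {n : ℕ} (w : Fin n → Fin n → ℕ) where

  weight : Edge n → ℕ
  weight (x , y) = w x y

  Normal : Edge n → Set
  Normal (x , y) = toℕ x < toℕ y

  EdgeLt : Edge n → Edge n → Set
  EdgeLt (x , y) (x' , y') =
    w x y < w x' y'
    ⊎ (w x y ≡ w x' y' × (toℕ x < toℕ x' ⊎ (x ≡ x' × toℕ y < toℕ y')))

  data Walk (F : List (Edge n)) : Fin n → Fin n → ℕ → Set where
    here : ∀ {x} → Walk F x x 0
    fwd  : ∀ {x y z d} → (x , y) ∈ F → Walk F y z d → Walk F x z (w x y + d)
    bwd  : ∀ {x y z d} → (y , x) ∈ F → Walk F y z d → Walk F x z (w y x + d)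

  IsDist : List (Edge n) → Fin n → Fin n → ℕ → Set
  IsDist F x y d = Walk F x y d × (∀ d' → Walk F x y d' → d ≤ d')

  Connected : List (Edge n) → Set
  Connected F = ∀ x y → ∃[ d ] Walk F x y d

  -- Generic greedy scan: Greedy Blocked es cur fin  means that scanning the
  -- edges es in order, starting from the current edge set cur, and adding an
  -- edge e iff ¬ Blocked (current set) e, yields the final edge set fin.
  data Greedy (Blocked : List (Edge n) → Edge n → Set)
       : List (Edge n) → List (Edge n) → List (Edge n) → Set where
    done : ∀ {cur} → Greedy Blocked [] cur cur
    add  : ∀ {e es cur fin} → ¬ Blocked cur e →
           Greedy Blocked es (cur ++ [ e ]) fin → Greedy Blocked (e ∷ es) cur fin
    skip : ∀ {e es cur fin} → Blocked cur e →
           Greedy Blocked es cur fin → Greedy Blocked (e ∷ es) cur fin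

  SpannerBlocked : ℚ → List (Edge n) → Edge n → Set
  SpannerBlocked t H (x , y) =
    ∃[ d ] (Walk H x y d × ℕ→ℚ d ℚ.≤ t ℚ.* ℕ→ℚ (w x y))

  KruskalBlocked : List (Edge n) → Edge n → Set
  KruskalBlocked Z (x , y) = ∃[ d ] Walk Z x y d

  Adj : List (Edge n) → Fin n → Fin n → Set
  Adj F x y = (x , y) ∈ F ⊎ (y , x) ∈ F

  -- depth-first search:  DFS F stack visited final
  -- (stack = current root-to-vertex path, top first; visited = vertices in
  --  visiting order; final = complete preorder)
  data DFS (F : List (Edge n)) : List (Fin n) → List (Fin n) → List (Fin n) → Set where
    finish    : ∀ {vis} → DFS F [] vis vis
    descend   : ∀ {x y stk vis fin} → Adj F x y → y ∉ vis →
                DFS F (y ∷ x ∷ stk) (vis ++ [ y ]) fin → DFS F (x ∷ stk) vis fin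
    backtrack : ∀ {x stk vis fin} → (∀ y → Adj F x y → y ∈ vis) →
                DFS F stk vis fin → DFS F (x ∷ stk) vis fin

  Preorder : List (Edge n) → Fin n → List (Fin n) → Set
  Preorder F r vs = DFS F [ r ] [ r ] vs

pathLen : {n : ℕ} → (Fin n → Fin n → ℕ) → List (Fin n) → ℕ
pathLen d [] = 0
pathLen d (x ∷ []) = 0
pathLen d (x ∷ y ∷ xs) = d x y + pathLen d (y ∷ xs)

-- Pos d vs u p : u occurs in vs as v_j and p = π(j) = Σ_{h=2}^{j} d(v_{h-1},v_h)
Pos : {n : ℕ} → (Fin n → Fin n → ℕ) → List (Fin n) → Fin n → ℕ → Set
Pos d vs u p = ∃[ pre ] ∃[ post ] (vs ≡ pre ++ u ∷ post × p ≡ pathLen d (pre ++ [ u ]))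

-- point p lies in interval I_j = {p_{(j-1)m}, …, p_{jm}}  (m = L/s)
InInterval : ℕ → ℕ → ℕ → Set
InInterval m j p = (j ∸ 1) * m ≤ p × p ≤ j * m

InN : (ℕ → ℕ) → ℕ → ℕ → ℕ → ℕ → Set
InN r s b j q = ∃[ h ] (1 ≤ h × h ≤ s × ∣ j - h ∣ ≤ b × q ≡ r h)

endpoints : List (ℕ × ℕ) → List ℕ
endpoints = concatMap (λ qq → proj₁ qq ∷ proj₂ qq ∷ [])

IsMaximalMatching : (ℕ → Set) → (ℕ → Set) → List (ℕ × ℕ) → Set
IsMaximalMatching A B M =
  All (λ qq → A (proj₁ qq) × B (proj₂ qq)) M
  × Unique (endpoints M)
  × (∀ x y → A x → B y → x ≢ y → x ∉ endpoints M → y ∉ endpoints M → ⊥)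

InEi : {n : ℕ} → (Fin n → Fin n → ℕ) → (H Z : List (Edge n)) →
       (k i L : ℕ) → Edge n → Set
InEi {n} w H Z k i L e =
  e ∈ H × e ∉ Z × k ^ (i ∸ 1) * L < weight w e * n × weight w e * n ≤ k ^ i * L

-- b = ⌊ num / den ⌋   (used with num/den = w(e)·n / (k^{i-1} L) = w(e)/a)
FloorDiv : ℕ → ℕ → ℕ → Set
FloorDiv num den b = b * den ≤ num × num < suc b * den

module Submission where

-- Let e = {u,v} precede e' = {u',v'} in the scan order and suppose their matchings share the pair {q,q'}.
-- Distinct representatives lie in distinct intervals, so the intervals of u and of one endpoint of e' are at
-- most b + b' apart, and likewise for v and the other endpoint.  Along the preorder, hence in Z, these
-- vertices are at distance at most c·L/s with c = b + b' + 1, which closes a u'–v' walk through e of length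
-- at most w(e') + 2c·L/s ≤ (1 + ε) w(e').  When the greedy spanner examined e' it already contained e and
-- the part of Kruskal's forest built so far; the tree edges Kruskal adds later are bridges that the walk can
-- drop, so e' was t-spanned and would have been rejected.

open import Defs
open import Data.Nat using (ℕ; suc; _+_; _*_; _∸_; _^_; _≤_; _<_; z≤n; s≤s; ∣_-_∣; NonZero; >-nonZero)
open import Data.Nat.Properties
open import Data.Nat.DivMod using (_/_; m/n*n≤m; m≡m%n+[m/n]*n; m%n<n)
import Data.Nat.Solver as ℕ-Solver
open import Data.Nat.Coprimality using (1-coprimeTo)
import Data.Nat.Coprimality as Coprime
import Data.Integer as ℤ
import Data.Integer.Properties as ℤ
open import Data.Rational as ℚ using (ℚ; mkℚ; 0ℚ; 1ℚ)
import Data.Rational.Properties as ℚ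
import Data.Rational.Solver as ℚ-Solver
open import Data.Fin using (Fin; toℕ)
open import Data.Fin.Properties using () renaming (_≟_ to _≟ᶠ_)
open import Data.List using (List; []; _∷_; _++_; [_])
open import Data.List.Properties using (++-assoc; ∷-injective)
open import Data.List.Membership.Propositional using (_∈_; _∉_)
open import Data.List.Membership.Propositional.Properties using (∈-++⁺ˡ; ∈-++⁺ʳ; ∈-++⁻; ∈-∃++)
open import Data.List.Relation.Binary.Subset.Propositional using (_⊆_)
open import Data.List.Relation.Binary.Subset.Propositional.Properties
  using (⊆-refl; ⊆-trans; ⊆-reflexive; xs⊆x∷xs; xs⊆xs++ys; ++⁺ˡ; ++⁺ʳ; ⊆-reflexive-↭)
open import Data.List.Relation.Binary.Permutation.Propositional.Properties using (shift)
open import Data.List.Relation.Unary.Any using (here; there)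
open import Data.List.Relation.Unary.All as All using (All; []; _∷_)
open import Data.List.Relation.Unary.AllPairs using (AllPairs; _∷_)
open import Data.Product using (∃-syntax; _×_; _,_; proj₁; proj₂)
open import Data.Sum as Sum using (_⊎_; inj₁; inj₂; [_,_]′)
open import Data.Empty using (⊥; ⊥-elim)
open import Relation.Binary using (tri<; tri≈; tri>)
open import Relation.Binary.PropositionalEquality
  using (_≡_; _≢_; refl; sym; trans; cong; cong₂; subst; subst₂; module ≡-Reasoning)
open import Relation.Nullary using (¬_; yes; no; contradiction)

module Walks {n : ℕ} (w : Fin n → Fin n → ℕ) where

  private variable
    F F' : List (Edge n)
    a b x y z : Fin n
    c d d₁ d₂ : ℕ

  Reachable : List (Edge n) → Fin n → Fin n → Set
  Reachable F x y = ∃[ d ] Walk w F x y d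

  ShortWalk : List (Edge n) → Fin n → Fin n → ℕ → Set
  ShortWalk F x y d = ∃[ d' ] (d' ≤ d × Walk w F x y d')

  infixr 5 _++ʷ_

  _++ʷ_ : Walk w F x y d₁ → Walk w F y z d₂ → Walk w F x z (d₁ + d₂)
  here ++ʷ q = q
  _++ʷ_ {d₂ = d₂} (fwd {x} {y} {d = d} e p) q =
    subst (Walk w _ x _) (sym (+-assoc (w x y) d d₂)) (fwd e (p ++ʷ q))
  _++ʷ_ {d₂ = d₂} (bwd {x} {y} {d = d} e p) q =
    subst (Walk w _ x _) (sym (+-assoc (w y x) d d₂)) (bwd e (p ++ʷ q))

  edgeʷ : (x , y) ∈ F → Walk w F x y (w x y)
  edgeʷ e = subst (Walk w _ _ _) (+-identityʳ _) (fwd e here)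

  edgeʳʷ : (x , y) ∈ F → Walk w F y x (w x y)
  edgeʳʷ e = subst (Walk w _ _ _) (+-identityʳ _) (bwd e here)

  reverseʷ : Walk w F x y d → Walk w F y x d
  reverseʷ here = here
  reverseʷ (fwd {x} {y} {d = d} e p) =
    subst (Walk w _ _ x) (+-comm d (w x y)) (reverseʷ p ++ʷ edgeʳʷ e)
  reverseʷ (bwd {x} {y} {d = d} e p) =
    subst (Walk w _ _ x) (+-comm d (w y x)) (reverseʷ p ++ʷ edgeʷ e)

  mapʷ : F ⊆ F' → Walk w F x y d → Walk w F' x y d
  mapʷ F⊆F' here      = here
  mapʷ F⊆F' (fwd e p) = fwd (F⊆F' e) (mapʷ F⊆F' p)
  mapʷ F⊆F' (bwd e p) = bwd (F⊆F' e) (mapʷ F⊆F' p)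

  reachable-refl : Reachable F x x
  reachable-refl = 0 , here

  reachable-sym : Reachable F x y → Reachable F y x
  reachable-sym (_ , p) = _ , reverseʷ p

  reachable-trans : Reachable F x y → Reachable F y z → Reachable F x z
  reachable-trans (_ , p) (_ , q) = _ , p ++ʷ q

  reachable-mono : F ⊆ F' → Reachable F x y → Reachable F' x y
  reachable-mono F⊆F' (_ , p) = _ , mapʷ F⊆F' p

  reachable-via : (∀ {a b} → (a , b) ∈ F → Reachable F' a b) → Walk w F x y d → Reachable F' x y
  reachable-via F↝F' here      = reachable-refl
  reachable-via F↝F' (fwd e p) = reachable-trans (F↝F' e) (reachable-via F↝F' p)
  reachable-via F↝F' (bwd e p) = reachable-trans (reachable-sym (F↝F' e)) (reachable-via F↝F' p)

  shortWalk-weaken : d₁ ≤ d₂ → ShortWalk F x y d₁ → ShortWalk F x y d₂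
  shortWalk-weaken d₁≤d₂ (d , d≤d₁ , p) = d , ≤-trans d≤d₁ d₁≤d₂ , p

  infixr 5 _++ˢ_

  _++ˢ_ : ShortWalk F x y d₁ → ShortWalk F y z d₂ → ShortWalk F x z (d₁ + d₂)
  (_ , ≤d₁ , p) ++ˢ (_ , ≤d₂ , q) = _ , +-mono-≤ ≤d₁ ≤d₂ , p ++ʷ q

  reverseˢ : ShortWalk F x y d → ShortWalk F y x d
  reverseˢ (_ , ≤d , p) = _ , ≤d , reverseʷ p

  mapˢ : F ⊆ F' → ShortWalk F x y d → ShortWalk F' x y d
  mapˢ F⊆F' (_ , ≤d , p) = _ , ≤d , mapʷ F⊆F' p

  module Bridge {F : List (Edge n)} {x y : Fin n} (x↮y : ¬ Reachable F x y) where

    -- As x and y lie in different F-components, only the last crossing of the bridge matters: a walk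
    -- a ⇝ b in (x , y) ∷ F is summarised by what is left of it after that crossing.
    Detour : Fin n → Fin n → ℕ → Set
    Detour a b d = ShortWalk F a b d
                 ⊎ (Reachable F a x × ShortWalk F y b d)
                 ⊎ (Reachable F a y × ShortWalk F x b d)

    detour-prepend : Walk w F a z c → Detour z b d → Detour a b (c + d)
    detour-prepend {c = c} p (inj₁ (d' , d'≤d , q)) = inj₁ (c + d' , +-monoʳ-≤ c d'≤d , p ++ʷ q)
    detour-prepend {c = c} p (inj₂ (inj₁ (z↝x , q))) =
      inj₂ (inj₁ (reachable-trans (_ , p) z↝x , shortWalk-weaken (m≤n+m _ c) q))
    detour-prepend {c = c} p (inj₂ (inj₂ (z↝y , q))) =
      inj₂ (inj₂ (reachable-trans (_ , p) z↝y , shortWalk-weaken (m≤n+m _ c) q))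

    cross-xy : Detour y b d → Detour x b (c + d)
    cross-xy {c = c} (inj₁ q)                  = inj₂ (inj₁ (reachable-refl , shortWalk-weaken (m≤n+m _ c) q))
    cross-xy         (inj₂ (inj₁ (y↝x , _)))   = ⊥-elim (x↮y (reachable-sym y↝x))
    cross-xy {c = c} (inj₂ (inj₂ (_ , q)))     = inj₁ (shortWalk-weaken (m≤n+m _ c) q)

    cross-yx : Detour x b d → Detour y b (c + d)
    cross-yx {c = c} (inj₁ q)                  = inj₂ (inj₂ (reachable-refl , shortWalk-weaken (m≤n+m _ c) q))
    cross-yx {c = c} (inj₂ (inj₁ (_ , q)))     = inj₁ (shortWalk-weaken (m≤n+m _ c) q)
    cross-yx         (inj₂ (inj₂ (x↝y , _)))   = ⊥-elim (x↮y x↝y)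

    detour : Walk w ((x , y) ∷ F) a b d → Detour a b d
    detour here                   = inj₁ (0 , z≤n , here)
    detour (fwd (here refl) p)    = cross-xy (detour p)
    detour (fwd (there e) p)      = detour-prepend (edgeʷ e) (detour p)
    detour (bwd (here refl) p)    = cross-yx (detour p)
    detour (bwd (there e) p)      = detour-prepend (edgeʳʷ e) (detour p)

    bridge-shortcut : Reachable F a b → Walk w ((x , y) ∷ F) a b d → ShortWalk F a b d
    bridge-shortcut a↝b p with detour p
    ... | inj₁ q = q
    ... | inj₂ (inj₁ (a↝x , (_ , _ , y→b))) =
      ⊥-elim (x↮y (reachable-trans (reachable-sym a↝x) (reachable-trans a↝b (reachable-sym (_ , y→b)))))
    ... | inj₂ (inj₂ (a↝y , (_ , _ , x→b))) =
      ⊥-elim (x↮y (reachable-trans (_ , x→b) (reachable-trans (reachable-sym a↝b) a↝y)))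

module _ {A : Set} {R : A → A → Set} where

  sorted-comparable : ∀ {xs x y} → AllPairs R xs → x ∈ xs → y ∈ xs → x ≢ y → R x y ⊎ R y x
  sorted-comparable (_ ∷ _)      (here refl) (here refl) x≢y = ⊥-elim (x≢y refl)
  sorted-comparable (x<ys ∷ _)   (here refl) (there y∈) _    = inj₁ (All.lookup x<ys y∈)
  sorted-comparable (y<xs ∷ _)   (there x∈)  (here refl) _   = inj₂ (All.lookup y<xs x∈)
  sorted-comparable (_ ∷ sorted) (there x∈)  (there y∈) x≢y  = sorted-comparable sorted x∈ y∈ x≢y

  sorted-split : ∀ pre {x post} → AllPairs R (pre ++ x ∷ post) → All (λ y → R y x) pre × All (R x) post
  sorted-split []        (x<post ∷ _)     = [] , x<post
  sorted-split (y ∷ pre) (y<rest ∷ sorted) =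
    let before , after = sorted-split pre sorted in All.lookup y<rest (∈-++⁺ʳ pre (here refl)) ∷ before , after

module EdgeOrder {n : ℕ} (w : Fin n → Fin n → ℕ) where

  EdgeLt-asym : ∀ {e f} → EdgeLt w e f → ¬ EdgeLt w f e
  EdgeLt-asym (inj₁ p)                   (inj₁ q)                   = <-asym p q
  EdgeLt-asym (inj₁ p)                   (inj₂ (q , _))             = <-irrefl (sym q) p
  EdgeLt-asym (inj₂ (p , _))             (inj₁ q)                   = <-irrefl (sym p) q
  EdgeLt-asym (inj₂ (_ , inj₁ p))        (inj₂ (_ , inj₁ q))        = <-asym p q
  EdgeLt-asym (inj₂ (_ , inj₁ p))        (inj₂ (_ , inj₂ (q , _)))  = <-irrefl (cong toℕ (sym q)) p
  EdgeLt-asym (inj₂ (_ , inj₂ (p , _)))  (inj₂ (_ , inj₁ q))        = <-irrefl (cong toℕ (sym p)) q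
  EdgeLt-asym (inj₂ (_ , inj₂ (_ , p)))  (inj₂ (_ , inj₂ (_ , q)))  = <-asym p q

  EdgeLt-irrefl : ∀ {e} → ¬ EdgeLt w e e
  EdgeLt-irrefl e<e = EdgeLt-asym e<e e<e

  EdgeLt⇒weight-≤ : ∀ {e f} → EdgeLt w e f → weight w e ≤ weight w f
  EdgeLt⇒weight-≤ (inj₁ p)       = <⇒≤ p
  EdgeLt⇒weight-≤ (inj₂ (p , _)) = ≤-reflexive p

module GreedyProperties {n : ℕ} {w : Fin n → Fin n → ℕ} {B : List (Edge n) → Edge n → Set} where

  private variable
    e : Edge n
    es cur fin : List (Edge n)

  greedy-⊇ : Greedy w B es cur fin → cur ⊆ fin
  greedy-⊇ done                  = ⊆-refl
  greedy-⊇ {cur = cur} (add _ g) = ⊆-trans (xs⊆xs++ys cur _) (greedy-⊇ g)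
  greedy-⊇ (skip _ g)            = greedy-⊇ g

  greedy-⊆ : Greedy w B es cur fin → fin ⊆ cur ++ es
  greedy-⊆ {cur = cur} done          = xs⊆xs++ys cur []
  greedy-⊆ {e ∷ es} {cur} (add _ g)  = ⊆-trans (greedy-⊆ g) (⊆-reflexive (++-assoc cur [ e ] es))
  greedy-⊆ {e ∷ es} {cur} (skip _ g) = ⊆-trans (greedy-⊆ g) (++⁺ʳ cur (xs⊆x∷xs es e))

  greedy-++ : ∀ pre → Greedy w B (pre ++ es) cur fin → ∃[ mid ] (Greedy w B pre cur mid × Greedy w B es mid fin)
  greedy-++ []        g          = _ , done , g
  greedy-++ (_ ∷ pre) (add b g)  = let mid , g₁ , g₂ = greedy-++ pre g in mid , add b g₁ , g₂
  greedy-++ (_ ∷ pre) (skip b g) = let mid , g₁ , g₂ = greedy-++ pre g in mid , skip b g₁ , g₂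

  greedy-blocked-or-kept : Greedy w B (e ∷ es) cur fin → B cur e ⊎ e ∈ fin
  greedy-blocked-or-kept {cur = cur} (add _ g) = inj₂ (greedy-⊇ g (∈-++⁺ʳ cur (here refl)))
  greedy-blocked-or-kept (skip b _)            = inj₁ b

  greedy-kept-unblocked : Greedy w B (e ∷ es) cur fin → e ∈ fin → e ∉ cur → e ∉ es → ¬ B cur e
  greedy-kept-unblocked (add ¬b _) _ _ _ = ¬b
  greedy-kept-unblocked {cur = cur} (skip _ g) e∈ e∉cur e∉es _ with ∈-++⁻ cur (greedy-⊆ g e∈)
  ... | inj₁ e∈cur = e∉cur e∈cur
  ... | inj₂ e∈es  = e∉es e∈es

ℕ→ℚ≡mkℚ : ∀ a → ℕ→ℚ a ≡ mkℚ (ℤ.+ a) 0 (Coprime.sym (1-coprimeTo a))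
ℕ→ℚ≡mkℚ a = ℚ.normalize-coprime (Coprime.sym (1-coprimeTo a))

ℕ→ℚ-+ : ∀ a b → ℕ→ℚ (a + b) ≡ ℕ→ℚ a ℚ.+ ℕ→ℚ b
ℕ→ℚ-+ a b rewrite ℕ→ℚ≡mkℚ a | ℕ→ℚ≡mkℚ b =
  cong (ℚ._/ 1) (trans (ℤ.pos-+ a b) (sym (cong₂ ℤ._+_ (ℤ.*-identityʳ (ℤ.+ a)) (ℤ.*-identityʳ (ℤ.+ b)))))

ℕ→ℚ-* : ∀ a b → ℕ→ℚ (a * b) ≡ ℕ→ℚ a ℚ.* ℕ→ℚ b
ℕ→ℚ-* a b rewrite ℕ→ℚ≡mkℚ a | ℕ→ℚ≡mkℚ b = cong (ℚ._/ 1) (ℤ.pos-* a b)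

ℕ→ℚ-mono-≤ : ∀ {a b} → a ≤ b → ℕ→ℚ a ℚ.≤ ℕ→ℚ b
ℕ→ℚ-mono-≤ {a} {b} a≤b rewrite ℕ→ℚ≡mkℚ a | ℕ→ℚ≡mkℚ b =
  ℚ.*≤* (subst₂ ℤ._≤_ (sym (ℤ.*-identityʳ (ℤ.+ a))) (sym (ℤ.*-identityʳ (ℤ.+ b))) (ℤ.+≤+ a≤b))

ℕ→ℚ-mono-< : ∀ {a b} → a < b → ℕ→ℚ a ℚ.< ℕ→ℚ b
ℕ→ℚ-mono-< {a} {b} a<b rewrite ℕ→ℚ≡mkℚ a | ℕ→ℚ≡mkℚ b =
  ℚ.*<* (subst₂ ℤ._<_ (sym (ℤ.*-identityʳ (ℤ.+ a))) (sym (ℤ.*-identityʳ (ℤ.+ b))) (ℤ.+<+ a<b))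

module Spanner {n : ℕ} (w : Fin n → Fin n → ℕ) where

  open Walks w
  open EdgeOrder w
  open GreedyProperties

  private variable
    e : Edge n
    es cur C G Z H Z₀ H₀ : List (Edge n)
    a b : Fin n
    d : ℕ

  kruskal-reaches : Greedy w (KruskalBlocked w) es cur Z → ∀ {x y} → (x , y) ∈ es → Reachable Z x y
  kruskal-reaches {cur = cur} (add _ g) (here refl) = _ , edgeʷ (greedy-⊇ g (∈-++⁺ʳ cur (here refl)))
  kruskal-reaches (skip x↝y g)          (here refl) = reachable-mono (greedy-⊇ g) x↝y
  kruskal-reaches (add _ g)             (there e∈)  = kruskal-reaches g e∈
  kruskal-reaches (skip _ g)            (there e∈)  = kruskal-reaches g e∈

  -- Each edge Kruskal adds after the state cur joins two components of cur ∪ C, so it is a bridge that a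
  -- walk between vertices connected in cur can drop.
  kruskal-shortcut : Greedy w (KruskalBlocked w) es cur Z → (∀ {x y} → (x , y) ∈ C → Reachable cur x y) →
                     Reachable cur a b → Walk w (Z ++ C) a b d → ShortWalk (cur ++ C) a b d
  kruskal-shortcut done       C↝ a↝b p = _ , ≤-refl , p
  kruskal-shortcut (skip _ g) C↝ a↝b p = kruskal-shortcut g C↝ a↝b p
  kruskal-shortcut {cur = cur} {C = C} (add {e = x , y} x↮y g) C↝ a↝b p =
    let d₁ , d₁≤d , p₁ = kruskal-shortcut g (λ e∈ → grow (C↝ e∈)) (grow a↝b) p
        d₂ , d₂≤d₁ , p₂ = Bridge.bridge-shortcut x↮y-outside (reachable-mono (xs⊆xs++ys cur C) a↝b)
                                                (mapʷ bring-forward p₁)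
    in d₂ , ≤-trans d₂≤d₁ d₁≤d , p₂
    where
    grow : ∀ {u v} → Reachable cur u v → Reachable (cur ++ [ (x , y) ]) u v
    grow = reachable-mono (xs⊆xs++ys cur _)

    x↮y-outside : ¬ Reachable (cur ++ C) x y
    x↮y-outside (_ , q) = x↮y (reachable-via cur++C↝cur q)
      where
      cur++C↝cur : ∀ {u v} → (u , v) ∈ cur ++ C → Reachable cur u v
      cur++C↝cur e∈ = [ (λ e∈cur → _ , edgeʷ e∈cur) , C↝ ]′ (∈-++⁻ cur e∈)

    bring-forward : (cur ++ [ (x , y) ]) ++ C ⊆ (x , y) ∷ cur ++ C
    bring-forward e∈ = ⊆-reflexive-↭ (shift (x , y) cur C) (subst (_ ∈_) (++-assoc cur [ (x , y) ] C) e∈)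

  SpanningSubgraph : List (Edge n) → List (Edge n) → Set
  SpanningSubgraph Z H = Z ⊆ H × (∀ {x y} → (x , y) ∈ H → Reachable Z x y)

  spanningSubgraph-add : ∀ {x y} → Z ⊆ H ++ [ (x , y) ] → (∀ {u v} → (u , v) ∈ H → Reachable Z u v) →
                         Reachable Z x y → SpanningSubgraph Z (H ++ [ (x , y) ])
  spanningSubgraph-add {H = H} Z⊆ H↝Z x↝y = Z⊆ , λ e∈ → [ H↝Z , (λ { (here refl) → x↝y }) ]′ (∈-++⁻ H e∈)

  -- The two scans run in lockstep; an edge Kruskal adds is never rejected by the spanner, since the
  -- current forest already connects the endpoints of every spanner edge.
  kruskal-spans-spanner : ∀ t → SpanningSubgraph Z₀ H₀ →
                          Greedy w (KruskalBlocked w) es Z₀ Z → Greedy w (SpannerBlocked w t) es H₀ H →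
                          SpanningSubgraph Z H
  kruskal-spans-spanner t inv done done = inv
  kruskal-spans-spanner {Z₀ = Z₀} t (Z₀⊆H₀ , H₀↝Z₀) (add _ gk) (add _ gs) =
    kruskal-spans-spanner t
      (spanningSubgraph-add (++⁺ˡ _ Z₀⊆H₀) (λ e∈ → reachable-mono (xs⊆xs++ys Z₀ _) (H₀↝Z₀ e∈))
                            (_ , edgeʷ (∈-++⁺ʳ Z₀ (here refl))))
      gk gs
  kruskal-spans-spanner t (_ , H₀↝Z₀) (add x↮y _) (skip (_ , p , _) _) = ⊥-elim (x↮y (reachable-via H₀↝Z₀ p))
  kruskal-spans-spanner t (Z₀⊆H₀ , H₀↝Z₀) (skip x↝y gk) (add _ gs) =
    kruskal-spans-spanner t (spanningSubgraph-add (λ e∈ → ∈-++⁺ˡ (Z₀⊆H₀ e∈)) H₀↝Z₀ x↝y) gk gs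
  kruskal-spans-spanner t inv (skip _ gk) (skip _ gs) = kruskal-spans-spanner t inv gk gs

  unspanned-by-earlier-edges : ∀ t →
    AllPairs (EdgeLt w) G → Greedy w (KruskalBlocked w) G [] Z → Greedy w (SpannerBlocked w t) G [] H →
    e ∈ H → e ∉ Z → All (λ f → f ∈ H × EdgeLt w f e) C → ¬ SpannerBlocked w t (Z ++ C) e
  unspanned-by-earlier-edges {e = x , y} {C = C} t sorted kruskal spanner e∈H e∉Z C-earlier (d , p , d≤t)
    with ∈-∃++ (greedy-⊆ spanner e∈H)
  ... | pre , post , refl with greedy-++ pre kruskal | greedy-++ pre spanner
  ... | Zc , kruskal₀ , kruskalₑ | Hc , spanner₀ , spannerₑ =
    let d' , d'≤d , p' = kruskal-shortcut kruskalₑ C↝Zc Zc↝e p in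
    greedy-kept-unblocked spannerₑ e∈H (λ e∈Hc → e∉pre (greedy-⊆ spanner₀ e∈Hc)) e∉post
      (d' , mapʷ Zc++C⊆Hc p' , ℚ.≤-trans (ℕ→ℚ-mono-≤ d'≤d) d≤t)
    where
    invariant = kruskal-spans-spanner t (⊆-refl , λ ()) kruskal₀ spanner₀
    Zc⊆Hc = proj₁ invariant
    Hc↝Zc = proj₂ invariant

    before = proj₁ (sorted-split pre sorted)
    after  = proj₂ (sorted-split pre sorted)

    e∉pre : (x , y) ∉ pre
    e∉pre e∈ = EdgeLt-irrefl (All.lookup before e∈)

    e∉post : (x , y) ∉ post
    e∉post e∈ = EdgeLt-irrefl (All.lookup after e∈)

    C⊆Hc : C ⊆ Hc
    C⊆Hc f∈C with All.lookup C-earlier f∈C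
    ... | f∈H , f<e with ∈-++⁻ Hc (greedy-⊆ spannerₑ f∈H)
    ...   | inj₁ f∈Hc           = f∈Hc
    ...   | inj₂ (here refl)    = ⊥-elim (EdgeLt-irrefl f<e)
    ...   | inj₂ (there f∈post) = ⊥-elim (EdgeLt-asym f<e (All.lookup after f∈post))

    C↝Zc : ∀ {u v} → (u , v) ∈ C → Reachable Zc u v
    C↝Zc f∈C = Hc↝Zc (C⊆Hc f∈C)

    Zc↝e : Reachable Zc x y
    Zc↝e = [ (λ x↝y → x↝y) , (λ e∈Z → ⊥-elim (e∉Z e∈Z)) ]′ (greedy-blocked-or-kept kruskalₑ)

    Zc++C⊆Hc : Zc ++ C ⊆ Hc
    Zc++C⊆Hc f∈ = [ Zc⊆Hc , C⊆Hc ]′ (∈-++⁻ Zc f∈)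

module Preorders {n : ℕ} (w : Fin n → Fin n → ℕ) {F : List (Edge n)} where

  Closed : List (Fin n) → Fin n → Set
  Closed vs x = ∀ y → Adj w F x y → y ∈ vs

  -- Vertices leave the stack only once all their neighbours are visited.
  dfs-closed : ∀ {stk vis fin} → DFS w F stk vis fin →
               vis ⊆ fin × (∀ {x} → x ∈ fin → Closed fin x ⊎ (x ∈ vis × x ∉ stk))
  dfs-closed finish = ⊆-refl , λ x∈ → inj₂ (x∈ , λ ())
  dfs-closed (descend {x} {y} {stk} {vis} {fin} _ _ d) with dfs-closed d
  ... | vis⊆fin , classify = (λ z∈ → vis⊆fin (∈-++⁺ˡ z∈)) , λ z∈ → [ inj₁ , visited-before ]′ (classify z∈)
    where
    visited-before : ∀ {z} → z ∈ vis ++ [ y ] × z ∉ y ∷ x ∷ stk → Closed fin z ⊎ (z ∈ vis × z ∉ x ∷ stk)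
    visited-before (z∈ , z∉) with ∈-++⁻ vis z∈
    ... | inj₁ z∈vis       = inj₂ (z∈vis , λ z∈stk → z∉ (there z∈stk))
    ... | inj₂ (here refl) = ⊥-elim (z∉ (here refl))
  dfs-closed (backtrack {x} {stk} {vis} {fin} nbrs d) with dfs-closed d
  ... | vis⊆fin , classify = vis⊆fin , λ z∈ → [ inj₁ , left-stack ]′ (classify z∈)
    where
    left-stack : ∀ {z} → z ∈ vis × z ∉ stk → Closed fin z ⊎ (z ∈ vis × z ∉ x ∷ stk)
    left-stack {z} (z∈ , z∉) with z ≟ᶠ x
    ... | yes refl = inj₁ (λ y adj → vis⊆fin (nbrs y adj))
    ... | no z≢x   = inj₂ (z∈ , λ { (here z≡x) → z≢x z≡x ; (there z∈stk) → z∉ z∈stk })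

  preorder-covers : ∀ {r vs u d} → Preorder w F r vs → Walk w F r u d → u ∈ vs
  preorder-covers {r} {vs} pre = reach (proj₁ (dfs-closed pre) (here refl))
    where
    closed : ∀ {x} → x ∈ vs → Closed vs x
    closed x∈ with proj₂ (dfs-closed pre) x∈
    ... | inj₁ c                  = c
    ... | inj₂ (here refl , x∉)   = ⊥-elim (x∉ (here refl))

    reach : ∀ {x u d} → x ∈ vs → Walk w F x u d → u ∈ vs
    reach x∈ here      = x∈
    reach x∈ (fwd e p) = reach (closed x∈ _ (inj₁ e)) p
    reach x∈ (bwd e p) = reach (closed x∈ _ (inj₂ e)) p

++-∷-split : ∀ {A : Set} (pre pre' : List A) {u u' post post'} → pre ++ u ∷ post ≡ pre' ++ u' ∷ post' →
             (pre ≡ pre' × u ≡ u') ⊎ (∃[ mid ] pre' ≡ pre ++ u ∷ mid) ⊎ (∃[ mid ] pre ≡ pre' ++ u' ∷ mid)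
++-∷-split []        []         refl = inj₁ (refl , refl)
++-∷-split []        (_ ∷ pre') refl = inj₂ (inj₁ (pre' , refl))
++-∷-split (_ ∷ pre) []         refl = inj₂ (inj₂ (pre , refl))
++-∷-split (_ ∷ pre) (_ ∷ pre') eq with ∷-injective eq
... | refl , eq′ with ++-∷-split pre pre' eq′
...   | inj₁ (refl , u≡u')       = inj₁ (refl , u≡u')
...   | inj₂ (inj₁ (mid , refl)) = inj₂ (inj₁ (mid , refl))
...   | inj₂ (inj₂ (mid , refl)) = inj₂ (inj₂ (mid , refl))

preorder-positions : ∀ {n} {w : Fin n → Fin n → ℕ} {G Z root vs} (dZ : Fin n → Fin n → ℕ) →
                     Connected w G → Greedy w (KruskalBlocked w) G [] Z → Preorder w Z root vs →
                     ∀ x → ∃[ p ] Pos dZ vs x p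
preorder-positions {w = w} {root = root} dZ G-connected kruskal preorder x
  with ∈-∃++ (Preorders.preorder-covers w preorder
               (proj₂ (Walks.reachable-via w (Spanner.kruskal-reaches w kruskal) (proj₂ (G-connected root x)))))
... | pre , post , vs≡ = _ , pre , post , vs≡ , refl

interval-gap : ∀ m {j j' p p'} → 1 ≤ j' → p ≤ j * m → (j' ∸ 1) * m ≤ p' → p ∸ p' ≤ suc ∣ j - j' ∣ * m
interval-gap m {j} {suc j₀} {p} {p'} _ p≤jm j₀m≤p' = m≤n+o⇒m∸n≤o p p' (begin
  p                                   ≤⟨ p≤jm ⟩
  j * m                               ≤⟨ *-monoˡ-≤ m (m≤n+∣m-n∣ j (suc j₀)) ⟩
  (suc j₀ + δ) * m                    ≡⟨ solve 3 (λ j₀ δ m → (con 1 :+ j₀ :+ δ) :* m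
                                                             := j₀ :* m :+ (con 1 :+ δ) :* m) refl j₀ δ m ⟩
  j₀ * m + suc δ * m                  ≤⟨ +-monoˡ-≤ (suc δ * m) j₀m≤p' ⟩
  p' + suc δ * m                      ∎)
  where
  open ≤-Reasoning
  open ℕ-Solver.+-*-Solver
  δ = ∣ j - suc j₀ ∣

interval-distance : ∀ m {j j' p p'} → 1 ≤ j → 1 ≤ j' → InInterval m j p → InInterval m j' p' →
                    ∣ p - p' ∣ ≤ suc ∣ j - j' ∣ * m
interval-distance m {j} {j'} {p} {p'} 1≤j 1≤j' (jm≤p , p≤jm) (j'm≤p' , p'≤j'm) with ∣m-n∣≡[m∸n]∨[n∸m] p p'
... | inj₁ eq = subst (_≤ _) (sym eq) (interval-gap m {j} 1≤j' p≤jm j'm≤p')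
... | inj₂ eq =
  subst₂ _≤_ (sym eq) (cong (λ δ → suc δ * m) (∣-∣-comm j' j)) (interval-gap m {j'} 1≤j p'≤j'm jm≤p)

module Representatives (s m : ℕ) (r : ℕ → ℕ)
                       (r-interior : ∀ j → 1 ≤ j → j ≤ s → (j ∸ 1) * m < r j × r j < j * m) where

  representative-increasing : ∀ {j j'} → 1 ≤ j → j < j' → j' ≤ s → r j < r j'
  representative-increasing {j} {j'} 1≤j j<j' j'≤s = begin-strict
    r j          <⟨ proj₂ (r-interior j 1≤j (≤-trans (<⇒≤ j<j') j'≤s)) ⟩
    j * m        ≤⟨ *-monoˡ-≤ m (∸-monoˡ-≤ 1 j<j') ⟩
    (j' ∸ 1) * m <⟨ proj₁ (r-interior j' (≤-trans 1≤j (<⇒≤ j<j')) j'≤s) ⟩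
    r j'         ∎
    where open ≤-Reasoning

  representative-injective : ∀ {j j'} → 1 ≤ j → j ≤ s → 1 ≤ j' → j' ≤ s → r j ≡ r j' → j ≡ j'
  representative-injective {j} {j'} 1≤j j≤s 1≤j' j'≤s rj≡rj' with <-cmp j j'
  ... | tri< j<j' _ _ = contradiction rj≡rj' (<⇒≢ (representative-increasing 1≤j j<j' j'≤s))
  ... | tri≈ _ j≡j' _ = j≡j'
  ... | tri> _ _ j>j' = contradiction (sym rj≡rj') (<⇒≢ (representative-increasing 1≤j' j>j' j≤s))

  shared-representative : ∀ {b b' j j' q} → InN r s b j q → InN r s b' j' q → ∣ j - j' ∣ ≤ b + b'
  shared-representative {b} {b'} {j} {j'} (h , 1≤h , h≤s , ∣j-h∣≤b , q≡rh)
                                          (h' , 1≤h' , h'≤s , ∣j'-h'∣≤b' , q≡rh')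
    with representative-injective 1≤h h≤s 1≤h' h'≤s (trans (sym q≡rh) q≡rh')
  ... | refl = begin
    ∣ j - j' ∣           ≤⟨ ∣-∣-triangle j h j' ⟩
    ∣ j - h ∣ + ∣ h - j' ∣ ≤⟨ +-mono-≤ ∣j-h∣≤b (subst (_≤ b') (∣-∣-comm j' h) ∣j'-h'∣≤b') ⟩
    b + b'               ∎
    where open ≤-Reasoning

module PreorderPositions {n : ℕ} (w : Fin n → Fin n → ℕ) {Z : List (Edge n)} {dZ : Fin n → Fin n → ℕ}
                         (Z-walk : ∀ x y → Walk w Z x y (dZ x y)) where

  open Walks w

  pathLen-++ : ∀ pre u post → pathLen dZ (pre ++ u ∷ post) ≡ pathLen dZ (pre ++ [ u ]) + pathLen dZ (u ∷ post)
  pathLen-++ []            u post = refl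
  pathLen-++ (x ∷ [])      u post = cong (_+ pathLen dZ (u ∷ post)) (sym (+-identityʳ (dZ x u)))
  pathLen-++ (x ∷ y ∷ pre) u post =
    trans (cong (dZ x y +_) (pathLen-++ (y ∷ pre) u post)) (sym (+-assoc (dZ x y) _ _))

  walk-along : ∀ u mid v → Walk w Z u v (pathLen dZ (u ∷ mid ++ [ v ]))
  walk-along u []        v = Z-walk u v ++ʷ here
  walk-along u (x ∷ mid) v = Z-walk u x ++ʷ walk-along x mid v

  walk-to-later : ∀ pre x mid y → ∃[ d ] (Walk w Z x y d ×
                    d ≡ ∣ pathLen dZ (pre ++ [ x ]) - pathLen dZ ((pre ++ x ∷ mid) ++ [ y ]) ∣)
  walk-to-later pre x mid y = _ , walk-along x mid y , sym (begin
    ∣ P - pathLen dZ ((pre ++ x ∷ mid) ++ [ y ]) ∣ ≡⟨ cong (λ p → ∣ P - pathLen dZ p ∣)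
                                                          (++-assoc pre (x ∷ mid) [ y ]) ⟩
    ∣ P - pathLen dZ (pre ++ x ∷ mid ++ [ y ]) ∣   ≡⟨ cong (λ p → ∣ P - p ∣) (pathLen-++ pre x (mid ++ [ y ])) ⟩
    ∣ P - P + pathLen dZ (x ∷ mid ++ [ y ]) ∣       ≡⟨ ∣m-m+n∣≡n P _ ⟩
    pathLen dZ (x ∷ mid ++ [ y ])                  ∎)
    where
    open ≡-Reasoning
    P = pathLen dZ (pre ++ [ x ])

  position-walk : ∀ {vs x y p p'} → Pos dZ vs x p → Pos dZ vs y p' → ∃[ d ] (Walk w Z x y d × d ≡ ∣ p - p' ∣)
  position-walk {x = x} {y} (pre , _ , refl , refl) (pre' , _ , eq , refl) with ++-∷-split pre pre' eq
  ... | inj₁ (refl , refl)       = 0 , here , sym (∣n-n∣≡0 (pathLen dZ (pre ++ [ x ])))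
  ... | inj₂ (inj₁ (mid , refl)) = walk-to-later pre x mid y
  ... | inj₂ (inj₂ (mid , refl)) =
    let d , walk , d≡ = walk-to-later pre' y mid x
    in d , reverseʷ walk , trans d≡ (∣-∣-comm (pathLen dZ (pre' ++ [ y ])) _)

detour-slack : ∀ {s m L A n w' b b'} → s * m ≡ L → b * A ≤ w' * n → b' * A ≤ w' * n → A ≤ w' * n →
               2 * (suc (b + b') * m) * (s * A) ≤ 8 * L * n * w'
detour-slack {s} {m} {L} {A} {n} {w'} {b} {b'} sm≡L bA≤W b'A≤W A≤W = begin
  2 * (suc (b + b') * m) * (s * A)   ≡⟨ solve 5 (λ b b' m s A → con 2 :* ((con 1 :+ b :+ b') :* m) :* (s :* A)
                                                        := con 2 :* (A :+ b :* A :+ b' :* A) :* (s :* m))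
                                              refl b b' m s A ⟩
  2 * (A + b * A + b' * A) * (s * m) ≡⟨ cong (2 * (A + b * A + b' * A) *_) sm≡L ⟩
  2 * (A + b * A + b' * A) * L       ≤⟨ *-monoˡ-≤ L (*-monoʳ-≤ 2 (+-mono-≤ (+-mono-≤ A≤W bA≤W) b'A≤W)) ⟩
  2 * (W + W + W) * L                ≡⟨ cong (_* L) (solve 1 (λ W → con 2 :* (W :+ W :+ W) := con 6 :* W)
                                                            refl W) ⟩
  6 * W * L                          ≤⟨ *-monoˡ-≤ L (*-monoˡ-≤ W (m≤m+n 6 2)) ⟩
  8 * W * L                          ≡⟨ solve 3 (λ w' n L → con 8 :* (w' :* n) :* L := con 8 :* L :* n :* w')
                                              refl w' n L ⟩
  8 * L * n * w'                     ∎
  where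
  open ≤-Reasoning
  open ℕ-Solver.+-*-Solver
  W = w' * n

slack-bound : ∀ {s A N x w'} (ε : ℚ) → 0 < s * A → ℕ→ℚ s ℚ.* ε ℚ.* ℕ→ℚ A ≡ ℕ→ℚ N →
              x * (s * A) ≤ N * w' → ℕ→ℚ x ℚ.≤ ε ℚ.* ℕ→ℚ w'
slack-bound {s} {A} {N} {x} {w'} ε sA>0 sεA≡N x·sA≤N·w' =
  ℚ.*-cancelʳ-≤-pos (ℕ→ℚ (s * A)) {{ℚ.positive (ℕ→ℚ-mono-< sA>0)}} (begin
    ℕ→ℚ x ℚ.* ℕ→ℚ (s * A)                 ≡⟨ sym (ℕ→ℚ-* x (s * A)) ⟩
    ℕ→ℚ (x * (s * A))                     ≤⟨ ℕ→ℚ-mono-≤ x·sA≤N·w' ⟩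
    ℕ→ℚ (N * w')                          ≡⟨ ℕ→ℚ-* N w' ⟩
    ℕ→ℚ N ℚ.* ℕ→ℚ w'                      ≡⟨ cong (ℚ._* ℕ→ℚ w') (sym sεA≡N) ⟩
    ℕ→ℚ s ℚ.* ε ℚ.* ℕ→ℚ A ℚ.* ℕ→ℚ w'      ≡⟨ solve 4 (λ s ε A w' → s :* ε :* A :* w' := ε :* w' :* (s :* A))
                                                     refl (ℕ→ℚ s) ε (ℕ→ℚ A) (ℕ→ℚ w') ⟩
    ε ℚ.* ℕ→ℚ w' ℚ.* (ℕ→ℚ s ℚ.* ℕ→ℚ A)   ≡⟨ cong (ε ℚ.* ℕ→ℚ w' ℚ.*_) (sym (ℕ→ℚ-* s A)) ⟩
    ε ℚ.* ℕ→ℚ w' ℚ.* ℕ→ℚ (s * A)         ∎)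
  where
  open ℚ.≤-Reasoning
  open ℚ-Solver.+-*-Solver

stretch-bound : ∀ {k' d x w'} {ε : ℚ} → 1 ≤ k' → 0ℚ ℚ.≤ ε → d ≤ w' + x → ℕ→ℚ x ℚ.≤ ε ℚ.* ℕ→ℚ w' →
                ℕ→ℚ d ℚ.≤ ℕ→ℚ k' ℚ.* (1ℚ ℚ.+ ε) ℚ.* ℕ→ℚ w'
stretch-bound {k'} {d} {x} {w'} {ε} 1≤k' ε≥0 d≤w'+x x≤εw' = begin
  ℕ→ℚ d                                  ≤⟨ ℕ→ℚ-mono-≤ d≤w'+x ⟩
  ℕ→ℚ (w' + x)                           ≡⟨ ℕ→ℚ-+ w' x ⟩
  ℕ→ℚ w' ℚ.+ ℕ→ℚ x                       ≤⟨ ℚ.+-monoʳ-≤ (ℕ→ℚ w') x≤εw' ⟩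
  ℕ→ℚ w' ℚ.+ ε ℚ.* ℕ→ℚ w'                ≡⟨ solve 2 (λ w' ε → w' :+ ε :* w' := con 1ℚ :* ((con 1ℚ :+ ε) :* w'))
                                                  refl (ℕ→ℚ w') ε ⟩
  1ℚ ℚ.* ((1ℚ ℚ.+ ε) ℚ.* ℕ→ℚ w')         ≤⟨ ℚ.*-monoʳ-≤-nonNeg ((1ℚ ℚ.+ ε) ℚ.* ℕ→ℚ w') (ℕ→ℚ-mono-≤ 1≤k') ⟩
  ℕ→ℚ k' ℚ.* ((1ℚ ℚ.+ ε) ℚ.* ℕ→ℚ w')     ≡⟨ sym (ℚ.*-assoc (ℕ→ℚ k') (1ℚ ℚ.+ ε) (ℕ→ℚ w')) ⟩
  ℕ→ℚ k' ℚ.* (1ℚ ℚ.+ ε) ℚ.* ℕ→ℚ w'       ∎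
  where
  open ℚ.≤-Reasoning
  open ℚ-Solver.+-*-Solver
  instance
    1+ε≥0 : ℚ.NonNegative (1ℚ ℚ.+ ε)
    1+ε≥0 = ℚ.nonNeg+nonNeg⇒nonNeg 1ℚ ε {{ℚ.nonNegative ε≥0}}
    w'≥0 : ℚ.NonNegative (ℕ→ℚ w')
    w'≥0 = ℚ.nonNegative (ℕ→ℚ-mono-≤ {0} {w'} z≤n)
    [1+ε]w'≥0 : ℚ.NonNegative ((1ℚ ℚ.+ ε) ℚ.* ℕ→ℚ w')
    [1+ε]w'≥0 = ℚ.nonNeg*nonNeg⇒nonNeg (1ℚ ℚ.+ ε) (ℕ→ℚ w')

module Layout {n : ℕ} (w : Fin n → Fin n → ℕ) {Z : List (Edge n)} {dZ : Fin n → Fin n → ℕ} {vs : List (Fin n)}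
              {s m : ℕ} {h : Fin n → ℕ} {r : ℕ → ℕ}
              (Z-walk : ∀ x y → Walk w Z x y (dZ x y))
              (h-interval : ∀ u p → Pos dZ vs u p → 1 ≤ h u × h u ≤ s × InInterval m (h u) p)
              (r-interior : ∀ j → 1 ≤ j → j ≤ s → (j ∸ 1) * m < r j × r j < j * m)
              (positioned : ∀ x → ∃[ p ] Pos dZ vs x p) where

  open Walks w
  open PreorderPositions w Z-walk
  open Representatives s m r r-interior

  layout-positive : Fin n → 0 < s × 0 < m
  layout-positive x with h-interval x _ (proj₂ (positioned x))
  ... | 1≤hx , hx≤s , _ = 0<s , subst (0 <_) (+-identityʳ m) (<-trans 0<r₁ r₁<m)
    where
    0<s = ≤-trans 1≤hx hx≤s
    0<r₁ = proj₁ (r-interior 1 ≤-refl 0<s)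
    r₁<m = proj₂ (r-interior 1 ≤-refl 0<s)

  walk-between-intervals : ∀ x y → ShortWalk Z x y (suc ∣ h x - h y ∣ * m)
  walk-between-intervals x y with positioned x | positioned y
  ... | _ , pos-x | _ , pos-y with position-walk pos-x pos-y | h-interval x _ pos-x | h-interval y _ pos-y
  ... | d , walk , d≡ | 1≤hx , _ , Ix | 1≤hy , _ , Iy =
    d , subst (_≤ _) (sym d≡) (interval-distance m 1≤hx 1≤hy Ix Iy) , walk

  walk-between-sharers : ∀ {x y b b' q} → InN r s b (h x) q → InN r s b' (h y) q →
                         ShortWalk Z x y (suc (b + b') * m)
  walk-between-sharers {x} {y} q-x q-y =
    shortWalk-weaken (*-monoˡ-≤ m (s≤s (shared-representative {j = h x} {h y} q-x q-y)))
                     (walk-between-intervals x y)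

  shared-pair-detour :
    ∀ {u v u' v' b b' q q'} → InN r s b (h u) q × InN r s b (h v) q' →
    (InN r s b' (h u') q × InN r s b' (h v') q') ⊎ (InN r s b' (h u') q' × InN r s b' (h v') q) →
    ShortWalk (Z ++ [ (u , v) ]) u' v' (suc (b + b') * m + (w u v + suc (b + b') * m))
  shared-pair-detour (q-u , q'-v) (inj₁ (q-u' , q'-v')) =
    mapˢ (xs⊆xs++ys Z _) (reverseˢ (walk-between-sharers q-u q-u')) ++ˢ
    (_ , ≤-refl , edgeʷ (∈-++⁺ʳ Z (here refl))) ++ˢ
    mapˢ (xs⊆xs++ys Z _) (walk-between-sharers q'-v q'-v')
  shared-pair-detour (q-u , q'-v) (inj₂ (q'-u' , q-v')) =
    mapˢ (xs⊆xs++ys Z _) (reverseˢ (walk-between-sharers q'-v q'-u')) ++ˢ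
    (_ , ≤-refl , edgeʳʷ (∈-++⁺ʳ Z (here refl))) ++ˢ
    mapˢ (xs⊆xs++ys Z _) (walk-between-sharers q-u q-v')

floorDiv-/ : ∀ num den .{{_ : NonZero den}} → FloorDiv num den (num / den)
floorDiv-/ num den =
  m/n*n≤m num den ,
  subst (_< suc (num / den) * den) (sym (m≡m%n+[m/n]*n num den)) (+-monoˡ-< ((num / den) * den) (m%n<n num den))

-- Everything is scaled by n: A = a·n with a = k^(i-1) L / n, so the hypothesis on s reads s ε a = 8 L and
-- bA ≤ w(e) n says b ≤ w(e)/a.  The detour is w(e) + 2cm with c = b + b' + 1 ≤ 3 w(e')/a and m = L/s = εa/8.
detour-within-stretch :
  ∀ {k s m L A n b b' w w' d} {ε : ℚ} → 2 ≤ k → 0ℚ ℚ.< ε → 0 < s * A →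
  ℕ→ℚ s ℚ.* ε ℚ.* ℕ→ℚ A ≡ ℕ→ℚ (8 * L * n) → s * m ≡ L →
  b * A ≤ w * n → w ≤ w' → b' * A ≤ w' * n → A < w' * n →
  d ≤ suc (b + b') * m + (w + suc (b + b') * m) →
  ℕ→ℚ d ℚ.≤ ℕ→ℚ (2 * k ∸ 1) ℚ.* (1ℚ ℚ.+ ε) ℚ.* ℕ→ℚ w'
detour-within-stretch {k} {s} {m} {L} {A} {n} {b} {b'} {w} {w'} {d} {ε}
                      2≤k ε>0 sA>0 sεA≡8Ln sm≡L bA≤wn w≤w' b'A≤w'n A<w'n d≤ =
  stretch-bound {2 * k ∸ 1} {d} {2 * (c * m)} {w'} 1≤2k-1 (ℚ.<⇒≤ ε>0) d≤w'+2cm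
    (slack-bound {s} {A} {8 * L * n} {2 * (c * m)} {w'} ε sA>0 sεA≡8Ln
      (detour-slack {s} {m} {L} {A} {n} {w'} {b} {b'} sm≡L bA≤w'n b'A≤w'n (<⇒≤ A<w'n)))
  where
  bA≤w'n = ≤-trans bA≤wn (*-monoˡ-≤ n w≤w')
  c = suc (b + b')
  1≤2k-1 : 1 ≤ 2 * k ∸ 1
  1≤2k-1 = ∸-monoˡ-≤ 1 (≤-trans 2≤k (m≤n*m k 2))
  d≤w'+2cm : d ≤ w' + 2 * (c * m)
  d≤w'+2cm = begin
    d                        ≤⟨ d≤ ⟩
    c * m + (w + c * m)      ≤⟨ +-monoʳ-≤ (c * m) (+-monoˡ-≤ (c * m) w≤w') ⟩
    c * m + (w' + c * m)     ≡⟨ solve 2 (λ x w' → x :+ (w' :+ x) := w' :+ con 2 :* x) refl (c * m) w' ⟩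
    w' + 2 * (c * m)         ∎
    where
    open ≤-Reasoning
    open ℕ-Solver.+-*-Solver

proposition2 :
  (n : ℕ) → 1 ≤ n →
  (w : Fin n → Fin n → ℕ) (G : List (Edge n)) →
  All (Normal w) G → AllPairs (EdgeLt w) G →
  All (λ e → 1 ≤ weight w e) G → Connected w G →
  (k : ℕ) → 2 ≤ k → (ε : ℚ) → 0ℚ ℚ.< ε →
  (i : ℕ) → 1 ≤ i → k ^ (i ∸ 1) < n →
  (Z H : List (Edge n)) →
  Greedy w (KruskalBlocked w) G [] Z →
  Greedy w (SpannerBlocked w (ℕ→ℚ (2 * k ∸ 1) ℚ.* (1ℚ ℚ.+ ε))) G [] H →
  (root : Fin n) (vs : List (Fin n)) → Preorder w Z root vs →
  (dZ : Fin n → Fin n → ℕ) → (∀ x y → IsDist w Z x y (dZ x y)) →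
  (s m : ℕ) →
  ℕ→ℚ s ℚ.* ε ℚ.* ℕ→ℚ (k ^ (i ∸ 1) * pathLen dZ vs) ≡ ℕ→ℚ (8 * pathLen dZ vs * n) →
  s * m ≡ pathLen dZ vs →
  (h : Fin n → ℕ) →
  (∀ u p → Pos dZ vs u p → 1 ≤ h u × h u ≤ s × InInterval m (h u) p) →
  (r : ℕ → ℕ) →
  (∀ j → 1 ≤ j → j ≤ s → (j ∸ 1) * m < r j × r j < j * m) →
  (M : Edge n → List (ℕ × ℕ)) →
  (∀ e → InEi w H Z k i (pathLen dZ vs) e →
     ∀ b → FloorDiv (weight w e * n) (k ^ (i ∸ 1) * pathLen dZ vs) b →
     IsMaximalMatching (InN r s b (h (proj₁ e))) (InN r s b (h (proj₂ e))) (M e)) →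
  ∀ e e' → InEi w H Z k i (pathLen dZ vs) e → InEi w H Z k i (pathLen dZ vs) e' →
  e ≢ e' → ∀ q q' → (q , q') ∈ M e → ¬ ((q , q') ∈ M e' ⊎ (q' , q) ∈ M e')
proposition2 n _ w G _ sorted _ G-connected k 2≤k ε ε>0 i _ _ Z H kruskal spanner root vs preorder dZ dZ-dist
             s m sεA≡8Ln sm≡L h h-interval r r-interior M matching e e' e∈Eᵢ e'∈Eᵢ e≢e' q q' qq'∈Mₑ shared =
  [ (λ e<e' → no-shared-pair e<e' e∈Eᵢ e'∈Eᵢ qq'∈Mₑ shared)
  , (λ e'<e → [ (λ qq'∈Mₑ' → no-shared-pair e'<e e'∈Eᵢ e∈Eᵢ qq'∈Mₑ' (inj₁ qq'∈Mₑ))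
              , (λ q'q∈Mₑ' → no-shared-pair e'<e e'∈Eᵢ e∈Eᵢ q'q∈Mₑ' (inj₂ qq'∈Mₑ)) ]′ shared)
  ]′ (sorted-comparable sorted (H⊆G (proj₁ e∈Eᵢ)) (H⊆G (proj₁ e'∈Eᵢ)) e≢e')
  where
  open EdgeOrder w
  open Layout w (λ x y → proj₁ (dZ-dist x y)) h-interval r-interior
              (preorder-positions dZ G-connected kruskal preorder)

  H⊆G : H ⊆ G
  H⊆G = GreedyProperties.greedy-⊆ spanner

  L = pathLen dZ vs
  A = k ^ (i ∸ 1) * L

  0<s = proj₁ (layout-positive root)
  0<m = proj₂ (layout-positive root)

  0<A : 0 < A
  0<A = *-mono-< (m^n>0 k {{>-nonZero (≤-trans (s≤s z≤n) 2≤k)}} (i ∸ 1)) (subst (0 <_) sm≡L (*-mono-< 0<s 0<m))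

  instance
    A≢0 : NonZero A
    A≢0 = >-nonZero 0<A

  no-shared-pair : ∀ {f f' p p'} → EdgeLt w f f' → InEi w H Z k i L f → InEi w H Z k i L f' →
                   (p , p') ∈ M f → (p , p') ∈ M f' ⊎ (p' , p) ∈ M f' → ⊥
  no-shared-pair {u , v} {u' , v'} f<f' f∈Eᵢ f'∈Eᵢ pair∈ pair∈' =
    Spanner.unspanned-by-earlier-edges w (ℕ→ℚ (2 * k ∸ 1) ℚ.* (1ℚ ℚ.+ ε)) sorted kruskal spanner
      (proj₁ f'∈Eᵢ) (proj₁ (proj₂ f'∈Eᵢ)) ((proj₁ f∈Eᵢ , f<f') ∷ [])
      (d , walk , detour-within-stretch {s = s} {m} {L} {A} {n} {b} {b'} 2≤k ε>0 (*-mono-< 0<s 0<A) sεA≡8Ln sm≡L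
                    (proj₁ floor) (EdgeLt⇒weight-≤ f<f') (proj₁ floor') (proj₁ (proj₂ (proj₂ f'∈Eᵢ))) d≤)
    where
    b  = w u v * n / A
    b' = w u' v' * n / A
    floor  = floorDiv-/ (w u v * n) A
    floor' = floorDiv-/ (w u' v' * n) A
    matched  = proj₁ (matching (u , v) f∈Eᵢ b floor)
    matched' = proj₁ (matching (u' , v') f'∈Eᵢ b' floor')
    detour = shared-pair-detour {b = b} {b'} (All.lookup matched pair∈)
               (Sum.map (All.lookup matched') (All.lookup matched') pair∈')
    d    = proj₁ detour
    d≤   = proj₁ (proj₂ detour)
    walk = proj₂ (proj₂ detour)
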